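{- There is an absolute constant $C_1$ such that for all positive integers $R,d$ with $Rd\ge 2$, every finite $d$-regular hypergraph $H=(V,\mathcal{E})$ in which every hyperedge has at most $R$ vertices admits a partition $\mathcal{E}=\mathcal{E}_1\uplus\mathcal{E}_2$ such that for $i=1,2$ every vertex lies in at least $d/2-C_1\sqrt{d\ln(Rd)}$ hyperedges of $\mathcal{E}_i$.
   Context: A hypergraph $H=(V,\mathcal{E})$ has finite vertex set $V$ and a finite multiset $\mathcal{E}$ of subsets of $V$; it is $d$-regular if every vertex lies in exactly $d$ hyperedges (with multiplicity). -}

module Defs where

open import Data.Nat using (ℕ; zero; suc; _+_; _*_; _∸_; _^_; _≤_)
open import Data.Bool using (Bool; true; false; _∧_; not)
open import Data.Fin using (Fin; zero; suc)
open import Data.Fin.Subset using (Subset)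
open import Data.Vec using (lookup)

count : ∀ {m} → (Fin m → Bool) → ℕ
count {zero} p = 0
count {suc m} p = (if p zero then 1 else 0) + count (λ j → p (suc j))
  where open import Data.Bool using (if_then_else_)

-- A hypergraph on vertex set Fin n with m hyperedges (a multiset, indexed by Fin m).
-- Hyperedge j is the subset E j of Fin n.

degIn : ∀ {n m} → (Fin m → Subset n) → (Fin m → Bool) → Fin n → ℕ
degIn E S v = count (λ j → S j ∧ lookup (E j) v)

deg : ∀ {n m} → (Fin m → Subset n) → Fin n → ℕ
deg E v = count (λ j → lookup (E j) v)

Regular : ∀ {n m} → ℕ → (Fin m → Subset n) → Set
Regular d E = ∀ v → deg E v ≡ d
  where open import Relation.Binary.PropositionalEquality using (_≡_)

-- The proof is the probabilistic method, made exact by counting over all 2^m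
-- colourings.  Then we prove the
-- Lovász Local Lemma in counting form: if every bad event is rare (relative
-- frequency ≤ 1/4D) even among colourings avoiding any family of non-adjacent
-- bad events, and adjacency has degree ≤ D, some colouring avoids all of them.
-- Next comes a Chernoff bound by exponential moments: with q = 2p and weights
-- (q+1)^red (q−1)^blue, a vertex of degree ≤ 16p²L is unbalanced by the margin
-- s = q(5L+4) for at most a 2^-(L+3) fraction of colourings.  For the
-- hypergraph, a vertex's bad event depends only on its own edges, so it is
-- adjacent to at most Rd vertices, and 2^(L+3) ≥ 4Rd.  Finally p is chosen with
-- 4p²L ≤ d ≤ 16p²L, so s² ≤ 81dL; if d < 4L every colouring works.

module Submission where

open import Defs
open import Data.Nat using (ℕ; zero; suc; _+_; _*_; _∸_; _^_; _≤_; _<_; z≤n; s≤s; _≤ᵇ_; _≤?_; >-nonZero)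
open import Data.Nat.Properties hiding (_≟_)
open import Data.Nat.Logarithm using (⌊log₂_⌋; ⌊log₂⌋-mono-≤; ⌊log₂[2^n]⌋≡n)
open import Data.Nat.Tactic.RingSolver using (solve-∀)
open import Data.Bool using (Bool; true; false; _∧_; _∨_; not; if_then_else_; T)
open import Data.Bool.Properties using (∧-comm; ∧-zeroʳ)
open import Data.Fin using (Fin; zero; suc; _≟_)
open import Data.Fin.Subset using (Subset; ∣_∣)
import Data.Vec as Vec
open import Data.Vec.Functional using (_∷_)
open import Data.List as List using (List; allFin)
open import Data.List.Relation.Unary.Any using (here; there)
open import Data.List.Membership.Propositional using (_∈_)
open import Data.List.Membership.Propositional.Properties using (∈-allFin)
open import Data.Product using (∃; _×_; _,_; proj₁; proj₂)
open import Data.Sum using (_⊎_; inj₁; inj₂)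
open import Data.Empty using (⊥-elim)
open import Relation.Nullary using (¬_; Dec; does; yes; no)
open import Relation.Binary.PropositionalEquality
open import Algebra.Properties.Semiring.Sum +-*-semiring using (sum; sum-syntax; sum-cong-≗; ∑-distrib-+; ∑-comm; *-distribˡ-sum)

ind : Bool → ℕ
ind b = if b then 1 else 0

ind-∧ : ∀ a b → ind (a ∧ b) ≡ ind a * ind b
ind-∧ true b = sym (+-identityʳ (ind b))
ind-∧ false b = refl

ind-∨ : ∀ a b → ind (a ∨ b) ≤ ind a + ind b
ind-∨ true b = s≤s z≤n
ind-∨ false b = ≤-refl

ind-mono : ∀ {a b : Bool} → (a ≡ true → b ≡ true) → ind a ≤ ind b
ind-mono {false} _ = z≤n
ind-mono {true} h rewrite h refl = ≤-refl

∧-elim : ∀ {a b} → a ∧ b ≡ true → a ≡ true × b ≡ true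
∧-elim {true} {true} _ = refl , refl

∨-elim : ∀ {a b} → a ∨ b ≡ false → a ≡ false × b ≡ false
∨-elim {false} {false} _ = refl , refl

every : ∀ {n} → (Fin n → Bool) → Bool
every {zero} f = true
every {suc n} f = f zero ∧ every (λ u → f (suc u))

every-elim : ∀ {n} {f : Fin n → Bool} → every f ≡ true → ∀ u → f u ≡ true
every-elim {suc n} {f} h zero with f zero
... | true = refl
every-elim {suc n} {f} h (suc u) with f zero
... | true = every-elim h u

every-intro : ∀ {n} {f : Fin n → Bool} → (∀ u → f u ≡ true) → every f ≡ true
every-intro {zero} h = refl
every-intro {suc n} {f} h rewrite h zero = every-intro (λ u → h (suc u))

every-witness : ∀ {n} {f : Fin n → Bool} → every f ≡ false → ∃ λ u → f u ≡ false
every-witness {suc n} {f} h with f zero in e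
... | false = zero , e
... | true = let (u , e′) = every-witness h in suc u , e′

every-cong : ∀ {n} {f g : Fin n → Bool} → (∀ u → f u ≡ g u) → every f ≡ every g
every-cong {zero} h = refl
every-cong {suc n} h = cong₂ _∧_ (h zero) (every-cong (λ u → h (suc u)))

sum-mono : ∀ {n} {f g : Fin n → ℕ} → (∀ j → f j ≤ g j) → sum f ≤ sum g
sum-mono {zero} h = z≤n
sum-mono {suc n} h = +-mono-≤ (h zero) (sum-mono (λ j → h (suc j)))

term≤sum : ∀ {n} (f : Fin n → ℕ) (u : Fin n) → f u ≤ sum f
term≤sum f zero = m≤m+n _ _
term≤sum f (suc u) = ≤-trans (term≤sum (λ j → f (suc j)) u) (m≤n+m _ _)

count≡sum : ∀ {n} (p : Fin n → Bool) → count p ≡ ∑[ j < n ] ind (p j)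
count≡sum {zero} p = refl
count≡sum {suc n} p = cong (ind (p zero) +_) (count≡sum (λ j → p (suc j)))

count-cong : ∀ {n} {p q : Fin n → Bool} → (∀ j → p j ≡ q j) → count p ≡ count q
count-cong {zero} e = refl
count-cong {suc n} e = cong₂ (λ a b → ind a + b) (e zero) (count-cong (λ j → e (suc j)))

count-mono : ∀ {n} {p q : Fin n → Bool} → (∀ j → p j ≡ true → q j ≡ true) → count p ≤ count q
count-mono {zero} h = z≤n
count-mono {suc n} h = +-mono-≤ (ind-mono (h zero)) (count-mono (λ j → h (suc j)))

count-strict : ∀ {n} {p q : Fin n → Bool} → (∀ j → p j ≡ true → q j ≡ true) →
  (u : Fin n) → q u ≡ true → p u ≡ false → count p < count q
count-strict {suc n} {p} {q} h zero qu pu rewrite qu | pu = s≤s (count-mono (λ j → h (suc j)))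
count-strict {suc n} h (suc u) qu pu =
  +-mono-≤-< (ind-mono (h zero)) (count-strict (λ j → h (suc j)) u qu pu)

count-split : ∀ {n} (b X : Fin n → Bool) →
  count (λ j → b j ∧ X j) + count (λ j → not (b j) ∧ X j) ≡ count X
count-split {zero} b X = refl
count-split {suc n} b X with b zero | X zero
... | true | true = cong suc (count-split (λ j → b (suc j)) (λ j → X (suc j)))
... | true | false = count-split (λ j → b (suc j)) (λ j → X (suc j))
... | false | true = trans (+-suc _ _) (cong suc (count-split (λ j → b (suc j)) (λ j → X (suc j))))
... | false | false = count-split (λ j → b (suc j)) (λ j → X (suc j))

card≡count : ∀ {n} (p : Subset n) → ∣ p ∣ ≡ count (Vec.lookup p)
card≡count Vec.[] = refl
card≡count (true Vec.∷ p) = cong suc (card≡count p)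
card≡count (false Vec.∷ p) = card≡count p

sum-selected : ∀ {n} (S : Fin n → Bool) (c : Fin n → ℕ) (k N : ℕ) →
  (∀ u → S u ≡ true → k * c u ≤ N) → k * (∑[ u < n ] (ind (S u) * c u)) ≤ count S * N
sum-selected {zero} S c k N h = ≤-reflexive (*-zeroʳ k)
sum-selected {suc n} S c k N h = begin
    k * (ind (S zero) * c zero + rest)              ≡⟨ *-distribˡ-+ k _ rest ⟩
    k * (ind (S zero) * c zero) + k * rest          ≤⟨ +-mono-≤ (selected (S zero) (h zero))
                                                         (sum-selected (λ u → S (suc u)) (λ u → c (suc u)) k N (λ u → h (suc u))) ⟩
    ind (S zero) * N + count (λ u → S (suc u)) * N  ≡⟨ sym (*-distribʳ-+ N (ind (S zero)) _) ⟩
    count S * N                                     ∎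
  where
    open ≤-Reasoning
    rest : ℕ
    rest = ∑[ u < n ] (ind (S (suc u)) * c (suc u))
    selected : ∀ s → (s ≡ true → k * c zero ≤ N) → k * (ind s * c zero) ≤ ind s * N
    selected true h₀ = ≤-trans (≤-reflexive (cong (k *_) (*-identityˡ (c zero))))
                                 (≤-trans (h₀ refl) (≤-reflexive (sym (*-identityˡ N))))
    selected false _ = ≤-reflexive (*-zeroʳ k)

Colouring : ℕ → Set
Colouring m = Fin m → Bool

sumC : ∀ {m} → (Colouring m → ℕ) → ℕ
sumC {zero} f = f (λ ())
sumC {suc m} f = sumC (λ ω → f (false ∷ ω)) + sumC (λ ω → f (true ∷ ω))

-- The number of colourings with property P (2^m times its probability).
#sat : ∀ {m} → (Colouring m → Bool) → ℕ
#sat P = sumC (λ ω → ind (P ω))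

sumC-cong : ∀ {m} {f g : Colouring m → ℕ} → (∀ ω → f ω ≡ g ω) → sumC f ≡ sumC g
sumC-cong {zero} e = e _
sumC-cong {suc m} e = cong₂ _+_ (sumC-cong (λ ω → e (false ∷ ω))) (sumC-cong (λ ω → e (true ∷ ω)))

sumC-mono : ∀ {m} {f g : Colouring m → ℕ} → (∀ ω → f ω ≤ g ω) → sumC f ≤ sumC g
sumC-mono {zero} h = h _
sumC-mono {suc m} h = +-mono-≤ (sumC-mono (λ ω → h (false ∷ ω))) (sumC-mono (λ ω → h (true ∷ ω)))

sumC-+ : ∀ {m} (f g : Colouring m → ℕ) → sumC (λ ω → f ω + g ω) ≡ sumC f + sumC g
sumC-+ {zero} f g = refl
sumC-+ {suc m} f g =
  trans (cong₂ _+_ (sumC-+ (λ ω → f (false ∷ ω)) (λ ω → g (false ∷ ω)))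
                   (sumC-+ (λ ω → f (true ∷ ω)) (λ ω → g (true ∷ ω))))
        (interchange (sumC (λ ω → f (false ∷ ω))) (sumC (λ ω → g (false ∷ ω)))
                     (sumC (λ ω → f (true ∷ ω))) (sumC (λ ω → g (true ∷ ω))))
  where
    interchange : ∀ a b c d → a + b + (c + d) ≡ a + c + (b + d)
    interchange = solve-∀

sumC-* : ∀ {m} (k : ℕ) (f : Colouring m → ℕ) → sumC (λ ω → k * f ω) ≡ k * sumC f
sumC-* {zero} k f = refl
sumC-* {suc m} k f =
  trans (cong₂ _+_ (sumC-* k (λ ω → f (false ∷ ω))) (sumC-* k (λ ω → f (true ∷ ω))))
        (sym (*-distribˡ-+ k _ _))

sumC-const : ∀ {m} (k : ℕ) → sumC {m} (λ _ → k) ≡ 2 ^ m * k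
sumC-const {zero} k = sym (+-identityʳ k)
sumC-const {suc m} k = trans (cong₂ _+_ (sumC-const {m} k) (sumC-const {m} k)) (doubling (2 ^ m) k)
  where
    doubling : ∀ a k → a * k + a * k ≡ (a + (a + 0)) * k
    doubling = solve-∀

sumC-∑ : ∀ {m n} (h : Fin n → Colouring m → ℕ) →
  sumC (λ ω → ∑[ u < n ] h u ω) ≡ ∑[ u < n ] sumC (h u)
sumC-∑ {zero} h = refl
sumC-∑ {suc m} h =
  trans (cong₂ _+_ (sumC-∑ (λ u ω → h u (false ∷ ω))) (sumC-∑ (λ u ω → h u (true ∷ ω))))
        (sym (∑-distrib-+ (λ u → sumC (λ ω → h u (false ∷ ω))) (λ u → sumC (λ ω → h u (true ∷ ω)))))

#sat-mono : ∀ {m} {P Q : Colouring m → Bool} → (∀ ω → P ω ≡ true → Q ω ≡ true) → #sat P ≤ #sat Q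
#sat-mono h = sumC-mono (λ ω → ind-mono (h ω))

#sat-∨ : ∀ {m} (P Q : Colouring m → Bool) → #sat (λ ω → P ω ∨ Q ω) ≤ #sat P + #sat Q
#sat-∨ P Q = ≤-trans (sumC-mono (λ ω → ind-∨ (P ω) (Q ω))) (≤-reflexive (sumC-+ (λ ω → ind (P ω)) (λ ω → ind (Q ω))))

#sat-witness : ∀ {m} (P : Colouring m → Bool) → 0 < #sat P → ∃ λ ω → P ω ≡ true
#sat-witness {zero} P h = _ , ind-positive h
  where
    ind-positive : ∀ {b} → 0 < ind b → b ≡ true
    ind-positive {true} _ = refl
#sat-witness {suc m} P h with positive-summand (#sat (λ ω → P (false ∷ ω))) h
  where
    positive-summand : ∀ a {b} → 0 < a + b → 0 < a ⊎ 0 < b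
    positive-summand zero h = inj₂ h
    positive-summand (suc a) _ = inj₁ (s≤s z≤n)
... | inj₁ h₀ = let (ω , p) = #sat-witness (λ ω → P (false ∷ ω)) h₀ in false ∷ ω , p
... | inj₂ h₁ = let (ω , p) = #sat-witness (λ ω → P (true ∷ ω)) h₁ in true ∷ ω , p

DependsOn : ∀ {m} → (Fin m → Bool) → (Colouring m → Bool) → Set
DependsOn X P = ∀ ω ω′ → (∀ j → X j ≡ true → ω j ≡ ω′ j) → P ω ≡ P ω′

dependsOn-tail : ∀ {m} {X : Fin (suc m) → Bool} {P : Colouring (suc m) → Bool} →
  DependsOn X P → ∀ b → DependsOn (λ j → X (suc j)) (λ ω → P (b ∷ ω))
dependsOn-tail dP b ω ω′ h = dP _ _ λ { zero _ → refl ; (suc j) e → h j e }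

ignores-zero : ∀ {m} {X : Fin (suc m) → Bool} {P : Colouring (suc m) → Bool} →
  DependsOn X P → X zero ≡ false → ∀ ω → P (true ∷ ω) ≡ P (false ∷ ω)
ignores-zero dP e ω = dP _ _ λ { zero e′ → ⊥-elim (true≢false (trans (sym e′) e)) ; (suc j) _ → refl }
  where
    true≢false : true ≡ false → _
    true≢false ()

product-swap : ∀ {m} (A B : Colouring m → Bool) (k : ℕ) →
  #sat (λ ω → A ω ∧ B ω) * k ≡ #sat A * #sat B → #sat (λ ω → B ω ∧ A ω) * k ≡ #sat B * #sat A
product-swap A B k e =
  trans (cong (_* k) (sumC-cong (λ ω → cong ind (∧-comm (B ω) (A ω))))) (trans e (*-comm (#sat A) (#sat B)))

product-step : ∀ {m} (A B : Colouring (suc m) → Bool) → (∀ ω → A (true ∷ ω) ≡ A (false ∷ ω)) →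
  (∀ b → #sat (λ ω → A (b ∷ ω) ∧ B (b ∷ ω)) * 2 ^ m ≡ #sat (λ ω → A (b ∷ ω)) * #sat (λ ω → B (b ∷ ω))) →
  #sat (λ ω → A ω ∧ B ω) * 2 ^ suc m ≡ #sat A * #sat B
product-step {m} A B ignores IH =
  trans (combine (#sat (λ ω → A (false ∷ ω) ∧ B (false ∷ ω))) (#sat (λ ω → A (true ∷ ω) ∧ B (true ∷ ω)))
                 a (#sat (λ ω → B (false ∷ ω))) (#sat (λ ω → B (true ∷ ω))) (2 ^ m) (IH false) (trans (IH true) (cong (_* #sat (λ ω → B (true ∷ ω))) a₁≡a)))
        (cong (λ x → (a + x) * #sat B) (sym a₁≡a))
  where
    a : ℕ
    a = #sat (λ ω → A (false ∷ ω))
    a₁≡a : #sat (λ ω → A (true ∷ ω)) ≡ a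
    a₁≡a = sumC-cong (λ ω → cong ind (ignores ω))
    combine : ∀ c₀ c₁ a b₀ b₁ P → c₀ * P ≡ a * b₀ → c₁ * P ≡ a * b₁ →
      (c₀ + c₁) * (2 * P) ≡ (a + a) * (b₀ + b₁)
    combine c₀ c₁ a b₀ b₁ P e₀ e₁ = begin
        (c₀ + c₁) * (2 * P)    ≡⟨ regroup c₀ c₁ P ⟩
        2 * (c₀ * P + c₁ * P)  ≡⟨ cong₂ (λ x y → 2 * (x + y)) e₀ e₁ ⟩
        2 * (a * b₀ + a * b₁)  ≡⟨ factor a b₀ b₁ ⟩
        (a + a) * (b₀ + b₁)    ∎
      where
        open ≡-Reasoning
        regroup : ∀ c₀ c₁ P → (c₀ + c₁) * (2 * P) ≡ 2 * (c₀ * P + c₁ * P)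
        regroup = solve-∀
        factor : ∀ a b₀ b₁ → 2 * (a * b₀ + a * b₁) ≡ (a + a) * (b₀ + b₁)
        factor = solve-∀

independent : ∀ {m} (X Y : Fin m → Bool) (A B : Colouring m → Bool) →
  (∀ j → X j ≡ true → Y j ≡ false) → DependsOn X A → DependsOn Y B →
  #sat (λ ω → A ω ∧ B ω) * 2 ^ m ≡ #sat A * #sat B
independent {zero} X Y A B disj dA dB = trans (*-identityʳ _) (ind-∧ (A _) (B _))
independent {suc m} X Y A B disj dA dB with X zero in eX
... | false = product-step A B (ignores-zero dA eX) IH
  where
    IH : ∀ b → #sat (λ ω → A (b ∷ ω) ∧ B (b ∷ ω)) * 2 ^ m ≡ #sat (λ ω → A (b ∷ ω)) * #sat (λ ω → B (b ∷ ω))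
    IH b = independent _ _ _ _ (λ j → disj (suc j)) (dependsOn-tail dA b) (dependsOn-tail dB b)
... | true = product-swap B A (2 ^ suc m) (product-step B A (ignores-zero dB (disj zero eX)) IH)
  where
    IH : ∀ b → #sat (λ ω → B (b ∷ ω) ∧ A (b ∷ ω)) * 2 ^ m ≡ #sat (λ ω → B (b ∷ ω)) * #sat (λ ω → A (b ∷ ω))
    IH b = product-swap (λ ω → A (b ∷ ω)) (λ ω → B (b ∷ ω)) (2 ^ m)
      (independent _ _ _ _ (λ j → disj (suc j)) (dependsOn-tail dA b) (dependsOn-tail dB b))

module LocalLemma {m n : ℕ} (bad : Fin n → Colouring m → Bool) (adj : Fin n → Fin n → Bool)
    (D : ℕ) (D≥1 : 1 ≤ D) (adj≤D : ∀ v → count (adj v) ≤ D) where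

  avoids : (Fin n → Bool) → Colouring m → Bool
  avoids S ω = every (λ u → not (S u ∧ bad u ω))

  LocalCondition : Set
  LocalCondition = ∀ v (T : Fin n → Bool) → (∀ u → T u ≡ true → adj v u ≡ false) →
    4 * D * #sat (λ ω → bad v ω ∧ avoids T ω) ≤ #sat (avoids T)

  avoids-antitone : ∀ {S T : Fin n → Bool} → (∀ u → T u ≡ true → S u ≡ true) →
    ∀ ω → avoids S ω ≡ true → avoids T ω ≡ true
  avoids-antitone {S} {T} T⊆S ω h = every-intro λ u → smaller (T u) (S u) (bad u ω) (T⊆S u) (every-elim h u)
    where
      smaller : ∀ t s b → (t ≡ true → s ≡ true) → not (s ∧ b) ≡ true → not (t ∧ b) ≡ true
      smaller false s b _ _ = refl
      smaller true s b h e rewrite h refl = e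

  -- A colouring avoiding T but not S has an event of S outside T occurring; if
  -- those all lie in S₁, counting them bounds the loss.
  union-bound : ∀ (S T S₁ : Fin n → Bool) → (∀ u → S u ≡ true → T u ≡ true ⊎ S₁ u ≡ true) →
    #sat (avoids T) ≤ #sat (avoids S) + ∑[ u < n ] (ind (S₁ u) * #sat (λ ω → bad u ω ∧ avoids T ω))
  union-bound S T S₁ cover = begin
      #sat (avoids T)
        ≤⟨ sumC-mono pointwise ⟩
      sumC (λ ω → ind (avoids S ω) + ∑[ u < n ] term u ω)
        ≡⟨ sumC-+ (λ ω → ind (avoids S ω)) (λ ω → ∑[ u < n ] term u ω) ⟩
      #sat (avoids S) + sumC (λ ω → ∑[ u < n ] term u ω)
        ≡⟨ cong (#sat (avoids S) +_) (sumC-∑ term) ⟩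
      #sat (avoids S) + ∑[ u < n ] sumC (term u)
        ≡⟨ cong (#sat (avoids S) +_) (sum-cong-≗ (λ u → sumC-* (ind (S₁ u)) (λ ω → ind (bad u ω ∧ avoids T ω)))) ⟩
      #sat (avoids S) + ∑[ u < n ] (ind (S₁ u) * #sat (λ ω → bad u ω ∧ avoids T ω)) ∎
    where
      open ≤-Reasoning
      term : Fin n → Colouring m → ℕ
      term u ω = ind (S₁ u) * ind (bad u ω ∧ avoids T ω)
      occurring : ∀ {s b} → s ≡ true → b ≡ true → 1 ≤ ind s * ind (b ∧ true)
      occurring refl refl = s≤s z≤n
      not-false : ∀ {x} → not x ≡ false → x ≡ true
      not-false {true} _ = refl
      pointwise : ∀ ω → ind (avoids T ω) ≤ ind (avoids S ω) + ∑[ u < n ] term u ω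
      pointwise ω with avoids T ω in eT | avoids S ω in eS
      ... | false | _ = z≤n
      ... | true | true = s≤s z≤n
      ... | true | false with every-witness eS
      ... | u , e with ∧-elim (not-false e)
      ... | Su , bu with cover u Su
      ... | inj₂ S₁u = ≤-trans (occurring S₁u bu) (term≤sum (λ u → ind (S₁ u) * ind (bad u ω ∧ true)) u)
      ... | inj₁ Tu with every-elim eT u
      ... | avoided rewrite Tu | bu = ⊥-elim (false≢true avoided)
        where
          false≢true : false ≡ true → _
          false≢true ()

  halve : ∀ N N₂ → 2 * D * N₂ ≤ 2 * D * N + D * N₂ → N₂ ≤ 2 * N
  halve N N₂ h = *-cancelˡ-≤ D {{>-nonZero D≥1}}
      (+-cancelʳ-≤ (D * N₂) (D * N₂) (D * (2 * N))
        (≤-trans (≤-reflexive (twice D N₂)) (≤-trans h (≤-reflexive (regroup D N N₂)))))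
    where
      twice : ∀ D N₂ → D * N₂ + D * N₂ ≡ 2 * D * N₂
      twice = solve-∀
      regroup : ∀ D N N₂ → 2 * D * N + D * N₂ ≡ D * (2 * N) + D * N₂
      regroup = solve-∀

  still-positive : ∀ {N N′ c} → 0 < N → N ≤ N′ + c → 2 * D * c ≤ N → 0 < N′
  still-positive {N′ = suc _} _ _ _ = s≤s z≤n
  still-positive {N} {zero} {c} N>0 N≤c 2Dc≤N = ⊥-elim (n≮0 (≤-trans N>0 (≤-trans N≤c c≤0)))
    where
      open ≤-Reasoning
      c≤0 : c ≤ 0
      c≤0 = +-cancelˡ-≤ c c 0 (begin
        c + c      ≡⟨ cong (c +_) (sym (+-identityʳ c)) ⟩
        2 * c      ≤⟨ *-monoˡ-≤ c (*-monoʳ-≤ 2 D≥1) ⟩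
        2 * D * c  ≤⟨ 2Dc≤N ⟩
        N          ≤⟨ N≤c ⟩
        c          ≡⟨ sym (+-identityʳ c) ⟩
        c + 0      ∎)

  module _ (local : LocalCondition) where

    conditional-bound : ∀ k (S : Fin n → Bool) → count S < k → ∀ v →
      2 * D * #sat (λ ω → bad v ω ∧ avoids S ω) ≤ #sat (avoids S)
    conditional-bound (suc k) S |S|≤k v =
      *-cancelˡ-≤ 2 (begin
        2 * (2 * D * a)  ≡⟨ double D a ⟩
        4 * D * a        ≤⟨ *-monoʳ-≤ (4 * D) a≤a₂ ⟩
        4 * D * a₂       ≤⟨ local v S₂ S₂-non-adjacent ⟩
        N₂               ≤⟨ halve N N₂ (≤-trans (*-monoʳ-≤ (2 * D) union) (≤-trans (≤-reflexive (*-distribˡ-+ (2 * D) N _))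
                                                 (+-monoʳ-≤ (2 * D * N) neighbours))) ⟩
        2 * N            ∎)
      where
        open ≤-Reasoning
        S₁ S₂ : Fin n → Bool
        S₁ u = S u ∧ adj v u
        S₂ u = S u ∧ not (adj v u)
        N N₂ a a₂ : ℕ
        N = #sat (avoids S)
        N₂ = #sat (avoids S₂)
        a = #sat (λ ω → bad v ω ∧ avoids S ω)
        a₂ = #sat (λ ω → bad v ω ∧ avoids S₂ ω)
        double : ∀ D a → 2 * (2 * D * a) ≡ 4 * D * a
        double = solve-∀
        S₂⊆S : ∀ u → S₂ u ≡ true → S u ≡ true
        S₂⊆S u h = proj₁ (∧-elim h)
        a≤a₂ : a ≤ a₂
        a≤a₂ = #sat-mono λ ω h → let (b , av) = ∧-elim h in
          cong₂ _∧_ b (avoids-antitone S₂⊆S ω av)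
        S₂-non-adjacent : ∀ u → S₂ u ≡ true → adj v u ≡ false
        S₂-non-adjacent u h = non-adjacent (S u) (adj v u) h
          where
            non-adjacent : ∀ x y → x ∧ not y ≡ true → y ≡ false
            non-adjacent true false _ = refl
        cover : ∀ u → S u ≡ true → S₂ u ≡ true ⊎ S₁ u ≡ true
        cover u Su with adj v u
        ... | true = inj₂ (cong (_∧ true) Su)
        ... | false = inj₁ (cong (_∧ true) Su)
        union : N₂ ≤ N + ∑[ u < n ] (ind (S₁ u) * #sat (λ ω → bad u ω ∧ avoids S₂ ω))
        union = union-bound S S₂ S₁ cover
        -- Each neighbour's event is handled by the induction hypothesis: S₂ is smaller than S.
        neighbour-bound : ∀ u → S₁ u ≡ true → 2 * D * #sat (λ ω → bad u ω ∧ avoids S₂ ω) ≤ N₂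
        neighbour-bound u h = conditional-bound k S₂ (≤-trans smaller (≤-pred |S|≤k)) u
          where
            excluded : ∀ x y → x ∧ y ≡ true → x ∧ not y ≡ false
            excluded true true _ = refl
            smaller : count S₂ < count S
            smaller = count-strict S₂⊆S u (proj₁ (∧-elim h)) (excluded (S u) (adj v u) h)
        neighbours : 2 * D * ∑[ u < n ] (ind (S₁ u) * #sat (λ ω → bad u ω ∧ avoids S₂ ω)) ≤ D * N₂
        neighbours = ≤-trans (sum-selected S₁ _ (2 * D) N₂ neighbour-bound)
          (*-monoˡ-≤ N₂ (≤-trans (count-mono {p = S₁} (λ u h → proj₂ (∧-elim h))) (adj≤D v)))

    listed : List (Fin n) → Fin n → Bool
    listed List.[] u = false
    listed (v List.∷ l) u = does (u ≟ v) ∨ listed l u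

    listed-∈ : ∀ {l u} → u ∈ l → listed l u ≡ true
    listed-∈ {v List.∷ l} {u} (here refl) with u ≟ u
    ... | yes _ = refl
    ... | no u≢u = ⊥-elim (u≢u refl)
    listed-∈ {v List.∷ l} {u} (there p) with does (u ≟ v)
    ... | true = refl
    ... | false = listed-∈ p

    -- Avoiding one more event keeps a positive number of colourings: the new
    -- event costs at most a 1/2D ≤ 1/2 fraction.
    avoids-positive : ∀ l → 0 < #sat (avoids (listed l))
    avoids-positive List.[] =
      ≤-trans (m^n>0 2 m) (≤-reflexive (trans (sym (*-identityʳ (2 ^ m)))
        (trans (sym (sumC-const {m} 1)) (sumC-cong {m} (λ ω → cong ind (sym (every-intro {n} (λ _ → refl))))))))
    avoids-positive (v List.∷ l) = still-positive (avoids-positive l)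
      (≤-trans (sumC-mono extend) (≤-reflexive (sumC-+ (λ ω → ind (avoids S′ ω)) (λ ω → ind (bad v ω ∧ avoids S ω)))))
      (conditional-bound (suc (count S)) S ≤-refl v)
      where
        S S′ : Fin n → Bool
        S = listed l
        S′ = listed (v List.∷ l)
        extend : ∀ ω → ind (avoids S ω) ≤ ind (avoids S′ ω) + ind (bad v ω ∧ avoids S ω)
        extend ω with avoids S ω in eS | bad v ω in ebad
        ... | false | _ = z≤n
        ... | true | true = m≤n+m _ _
        ... | true | false = ≤-trans (≤-reflexive (cong ind (sym avoids′))) (m≤m+n _ _)
          where
            avoids′ : avoids S′ ω ≡ true
            avoids′ = every-intro λ u → fresh u
              where
                fresh : ∀ u → not (S′ u ∧ bad u ω) ≡ true
                fresh u with u ≟ v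
                ... | yes refl rewrite ebad = refl
                ... | no _ = every-elim eS u

    local-lemma : ∃ λ ω → ∀ u → bad u ω ≡ false
    local-lemma = let (ω , e) = #sat-witness (avoids (listed (allFin n))) (avoids-positive (allFin n)) in
      ω , λ u → never (listed-∈ (∈-allFin u)) (every-elim e u)
      where
        never : ∀ {a b} → a ≡ true → not (a ∧ b) ≡ true → b ≡ false
        never {true} {false} _ _ = refl

*-^ : ∀ a b c → (a * b) ^ c ≡ a ^ c * b ^ c
*-^ a b zero = refl
*-^ a b (suc c) = trans (cong (a * b *_) (*-^ a b c)) (interchange a b (a ^ c) (b ^ c))
  where
    interchange : ∀ a b x y → a * b * (x * y) ≡ a * x * (b * y)
    interchange = solve-∀

^-positive : ∀ a c → 1 ≤ a → 1 ≤ a ^ c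
^-positive a zero h = ≤-refl
^-positive a (suc c) h = *-mono-≤ h (^-positive a c h)

-- From A^N ≤ k·B^N (with B ≤ A) we get A^y ≤ k^c·B^y for every y ≤ N·c:
-- raise to the c-th power, then drop the surplus exponent N·c − y.
power-transfer : ∀ A B k N c y → 1 ≤ A → B ≤ A → A ^ N ≤ k * B ^ N → y ≤ N * c →
  A ^ y ≤ k ^ c * B ^ y
power-transfer A B k N c y A≥1 B≤A h y≤Nc =
  *-cancelʳ-≤ (A ^ y) (k ^ c * B ^ y) (A ^ z) {{>-nonZero (^-positive A z A≥1)}} (begin
    A ^ y * A ^ z            ≡⟨ sym (^-distribˡ-+-* A y z) ⟩
    A ^ (y + z)              ≡⟨ cong (A ^_) y+z≡Nc ⟩
    A ^ (N * c)              ≡⟨ sym (^-*-assoc A N c) ⟩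
    (A ^ N) ^ c              ≤⟨ ^-monoˡ-≤ c h ⟩
    (k * B ^ N) ^ c          ≡⟨ trans (*-^ k (B ^ N) c) (cong (k ^ c *_) (^-*-assoc B N c)) ⟩
    k ^ c * B ^ (N * c)      ≡⟨ cong (λ w → k ^ c * B ^ w) (sym y+z≡Nc) ⟩
    k ^ c * B ^ (y + z)      ≡⟨ cong (k ^ c *_) (^-distribˡ-+-* B y z) ⟩
    k ^ c * (B ^ y * B ^ z)  ≤⟨ *-monoʳ-≤ (k ^ c) (*-monoʳ-≤ (B ^ y) (^-monoˡ-≤ z B≤A)) ⟩
    k ^ c * (B ^ y * A ^ z)  ≡⟨ sym (*-assoc (k ^ c) (B ^ y) (A ^ z)) ⟩
    k ^ c * B ^ y * A ^ z    ∎)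
  where
    open ≤-Reasoning
    z : ℕ
    z = N * c ∸ y
    y+z≡Nc : y + z ≡ N * c
    y+z≡Nc = m+[n∸m]≡n y≤Nc

-- Bernoulli's inequality (1 + 1/q)^n ≥ 1 + n/q, cleared of denominators.
bernoulli-up : ∀ q n → q ^ n * (q + n) ≤ q * (q + 1) ^ n
bernoulli-up q zero = ≤-reflexive (trans (+-identityʳ (q + 0)) (trans (+-identityʳ q) (sym (*-identityʳ q))))
bernoulli-up q (suc n) = begin
    q * q ^ n * (q + suc n)                     ≡⟨ expand q (q ^ n) n ⟩
    q ^ n * (q + n) * q + q ^ n * q              ≤⟨ m≤m+n _ (q ^ n * n) ⟩
    q ^ n * (q + n) * q + q ^ n * q + q ^ n * n  ≡⟨ collect q (q ^ n) n ⟩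
    (q + 1) * (q ^ n * (q + n))                  ≤⟨ *-monoʳ-≤ (q + 1) (bernoulli-up q n) ⟩
    (q + 1) * (q * (q + 1) ^ n)                  ≡⟨ swap q ((q + 1) ^ n) ⟩
    q * ((q + 1) * (q + 1) ^ n)                  ∎
  where
    open ≤-Reasoning
    expand : ∀ q x n → q * x * (q + suc n) ≡ x * (q + n) * q + x * q
    expand = solve-∀
    collect : ∀ q x n → x * (q + n) * q + x * q + x * n ≡ (q + 1) * (x * (q + n))
    collect = solve-∀
    swap : ∀ q y → (q + 1) * (q * y) ≡ q * ((q + 1) * y)
    swap = solve-∀

two≤growth : ∀ q → 1 ≤ q → 2 * q ^ q ≤ (q + 1) ^ q
two≤growth q q≥1 = *-cancelˡ-≤ q {{>-nonZero q≥1}} (begin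
    q * (2 * q ^ q)  ≡⟨ rearrange q (q ^ q) ⟩
    q ^ q * (q + q)  ≤⟨ bernoulli-up q q ⟩
    q * (q + 1) ^ q  ∎)
  where
    open ≤-Reasoning
    rearrange : ∀ q x → q * (2 * x) ≡ x * (q + q)
    rearrange = solve-∀

-- Bernoulli downwards: (1 − 1/(Q+1))^n ≥ (t+1)/(Q+1) when n + t = Q.
bernoulli-down : ∀ Q n t → n + t ≡ Q → suc Q ^ n * suc t ≤ suc Q * Q ^ n
bernoulli-down Q zero t refl = ≤-reflexive (trans (+-identityʳ _) (sym (*-identityʳ _)))
bernoulli-down Q (suc n) t e = begin
    suc Q * suc Q ^ n * suc t
      ≡⟨ cong (λ w → suc w * suc w ^ n * suc t) (sym e′) ⟩
    suc (n + suc t) * suc (n + suc t) ^ n * suc t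
      ≤⟨ m≤m+n _ (suc (n + suc t) ^ n * n) ⟩
    suc (n + suc t) * suc (n + suc t) ^ n * suc t + suc (n + suc t) ^ n * n
      ≡⟨ collect n t (suc (n + suc t) ^ n) ⟩
    suc (n + suc t) ^ n * suc (suc t) * (n + suc t)
      ≡⟨ cong (λ w → suc w ^ n * suc (suc t) * w) e′ ⟩
    suc Q ^ n * suc (suc t) * Q
      ≤⟨ *-monoˡ-≤ Q (bernoulli-down Q n (suc t) e′) ⟩
    suc Q * Q ^ n * Q
      ≡⟨ *-assoc (suc Q) (Q ^ n) Q ⟩
    suc Q * (Q ^ n * Q)
      ≡⟨ cong (suc Q *_) (*-comm (Q ^ n) Q) ⟩
    suc Q * (Q * Q ^ n) ∎
  where
    open ≤-Reasoning
    e′ : n + suc t ≡ Q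
    e′ = trans (+-suc n t) e
    collect : ∀ n t x → suc (n + suc t) * x * suc t + x * n ≡ x * suc (suc t) * (n + suc t)
    collect = solve-∀

-- For q = 2p: (1 − 1/q²)^(q²/2) ≥ 1/2, i.e. (q²)^(2p²) ≤ 2·((q+1)(q−1))^(2p²).
-- Here p = suc p′, so q − 1 = 2p′ + 1.
squares-near-one : ∀ p′ → let p = suc p′ ; N = 2 * p * p in
  (2 * p * (2 * p)) ^ N ≤ 2 * ((2 * p + 1) * (2 * p′ + 1)) ^ N
squares-near-one p′ = *-cancelʳ-≤ (Q ^ N) (2 * Q′ ^ N) N {{>-nonZero (s≤s z≤n)}} (begin
    Q ^ N * N              ≡⟨ cong₂ (λ a b → a ^ N * b) (sym eQ) (sym eN) ⟩
    suc Q′ ^ N * suc t     ≤⟨ bernoulli-down Q′ N t eNt ⟩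
    suc Q′ * Q′ ^ N        ≡⟨ cong (_* Q′ ^ N) eQ ⟩
    Q * Q′ ^ N             ≡⟨ cong (_* Q′ ^ N) eQ2 ⟩
    2 * N * Q′ ^ N         ≡⟨ rearrange N (Q′ ^ N) ⟩
    2 * Q′ ^ N * N         ∎)
  where
    open ≤-Reasoning
    p = suc p′
    N Q Q′ t : ℕ
    N = 2 * p * p
    Q = 2 * p * (2 * p)
    Q′ = (2 * p + 1) * (2 * p′ + 1)
    t = 2 * p′ * p′ + 4 * p′ + 1
    eNt : N + t ≡ Q′
    eNt = identity p′
      where
        identity : ∀ p′ → 2 * suc p′ * suc p′ + (2 * p′ * p′ + 4 * p′ + 1) ≡ (2 * suc p′ + 1) * (2 * p′ + 1)
        identity = solve-∀
    eQ : suc Q′ ≡ Q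
    eQ = identity p′
      where
        identity : ∀ p′ → suc ((2 * suc p′ + 1) * (2 * p′ + 1)) ≡ 2 * suc p′ * (2 * suc p′)
        identity = solve-∀
    eN : suc t ≡ N
    eN = identity p′
      where
        identity : ∀ p′ → suc (2 * p′ * p′ + 4 * p′ + 1) ≡ 2 * suc p′ * suc p′
        identity = solve-∀
    eQ2 : Q ≡ 2 * N
    eQ2 = identity p′
      where
        identity : ∀ p′ → 2 * suc p′ * (2 * suc p′) ≡ 2 * (2 * suc p′ * suc p′)
        identity = solve-∀
    rearrange : ∀ a b → 2 * a * b ≡ 2 * b * a
    rearrange = solve-∀

weight-bound : ∀ p′ L x y → let q = 2 * suc p′ in
  x + y ≤ 16 * suc p′ * suc p′ * L → y + q * (5 * L + 4) ≤ x →
  2 ^ (L + 4) * q ^ (x + y) ≤ (q + 1) ^ x * (2 * p′ + 1) ^ y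
weight-bound p′ L x y x+y≤ margin = *-cancelˡ-≤ (2 ^ (4 * L)) {{>-nonZero (^-positive 2 (4 * L) (s≤s z≤n))}} (begin
    2 ^ (4 * L) * (2 ^ (L + 4) * q ^ (x + y))
      ≡⟨ trans (sym (*-assoc (2 ^ (4 * L)) _ _)) (cong (_* q ^ (x + y)) (trans (sym (^-distribˡ-+-* 2 (4 * L) (L + 4))) (cong (2 ^_) (exponents L)))) ⟩
    2 ^ (5 * L + 4) * q ^ (x + y)
      ≡⟨ cong (2 ^ (5 * L + 4) *_) q-powers ⟩
    2 ^ (5 * L + 4) * ((q * q) ^ y * q ^ s * q ^ r)
      ≡⟨ regroup (2 ^ (5 * L + 4)) ((q * q) ^ y) (q ^ s) (q ^ r) ⟩
    (q * q) ^ y * (2 ^ (5 * L + 4) * q ^ s) * q ^ r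
      ≤⟨ *-mono-≤ (*-mono-≤ square-factor linear-factor) (^-monoˡ-≤ r (m≤m+n q 1)) ⟩
    2 ^ (4 * L) * Q′ ^ y * (q + 1) ^ s * (q + 1) ^ r
      ≡⟨ cong (λ w → 2 ^ (4 * L) * w * (q + 1) ^ s * (q + 1) ^ r) (*-^ (q + 1) (2 * p′ + 1) y) ⟩
    2 ^ (4 * L) * ((q + 1) ^ y * (2 * p′ + 1) ^ y) * (q + 1) ^ s * (q + 1) ^ r
      ≡⟨ regroup′ (2 ^ (4 * L)) ((q + 1) ^ y) ((2 * p′ + 1) ^ y) ((q + 1) ^ s) ((q + 1) ^ r) ⟩
    2 ^ (4 * L) * ((q + 1) ^ y * (q + 1) ^ s * (q + 1) ^ r * (2 * p′ + 1) ^ y)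
      ≡⟨ cong (λ w → 2 ^ (4 * L) * (w * (2 * p′ + 1) ^ y)) (sym (split-exponent (q + 1) y s r)) ⟩
    2 ^ (4 * L) * ((q + 1) ^ (y + s + r) * (2 * p′ + 1) ^ y)
      ≡⟨ cong (λ w → 2 ^ (4 * L) * ((q + 1) ^ w * (2 * p′ + 1) ^ y)) y+s+r≡x ⟩
    2 ^ (4 * L) * ((q + 1) ^ x * (2 * p′ + 1) ^ y) ∎)
  where
    open ≤-Reasoning
    p = suc p′
    q s r Q′ : ℕ
    q = 2 * p
    s = q * (5 * L + 4)
    r = x ∸ (y + s)
    Q′ = (q + 1) * (2 * p′ + 1)
    y+s+r≡x : y + s + r ≡ x
    y+s+r≡x = m+[n∸m]≡n margin
    split-exponent : ∀ a i j k → a ^ (i + j + k) ≡ a ^ i * a ^ j * a ^ k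
    split-exponent a i j k = trans (^-distribˡ-+-* a (i + j) k) (cong (_* a ^ k) (^-distribˡ-+-* a i j))
    q-powers : q ^ (x + y) ≡ (q * q) ^ y * q ^ s * q ^ r
    q-powers = begin-equality
      q ^ (x + y)                   ≡⟨ cong (λ w → q ^ (w + y)) (sym y+s+r≡x) ⟩
      q ^ (y + s + r + y)           ≡⟨ cong (q ^_) (reorder y s r) ⟩
      q ^ ((y + y) + s + r)         ≡⟨ split-exponent q (y + y) s r ⟩
      q ^ (y + y) * q ^ s * q ^ r   ≡⟨ cong (λ w → w * q ^ s * q ^ r) (trans (^-distribˡ-+-* q y y) (sym (*-^ q q y))) ⟩
      (q * q) ^ y * q ^ s * q ^ r   ∎
      where
        reorder : ∀ y s r → y + s + r + y ≡ (y + y) + s + r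
        reorder = solve-∀
    -- y ≤ 2p²·4L because 2y ≤ x + y ≤ 16p²L.
    y≤ : y ≤ 2 * p * p * (4 * L)
    y≤ = *-cancelˡ-≤ 2 (begin
      2 * y                     ≡⟨ cong (y +_) (+-identityʳ y) ⟩
      y + y                     ≤⟨ +-monoˡ-≤ y (≤-trans (m≤m+n y s) margin) ⟩
      x + y                     ≤⟨ x+y≤ ⟩
      16 * p * p * L            ≡⟨ rearrange p L ⟩
      2 * (2 * p * p * (4 * L)) ∎)
      where
        rearrange : ∀ p L → 16 * p * p * L ≡ 2 * (2 * p * p * (4 * L))
        rearrange = solve-∀
    square-factor : (q * q) ^ y ≤ 2 ^ (4 * L) * Q′ ^ y
    square-factor = power-transfer (q * q) Q′ 2 (2 * p * p) (4 * L) y (s≤s z≤n)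
      (≤-trans (n≤1+n Q′) (≤-reflexive (product p′))) (squares-near-one p′) y≤
      where
        product : ∀ p′ → suc ((2 * suc p′ + 1) * (2 * p′ + 1)) ≡ 2 * suc p′ * (2 * suc p′)
        product = solve-∀
    linear-factor : 2 ^ (5 * L + 4) * q ^ s ≤ (q + 1) ^ s
    linear-factor = begin
      2 ^ (5 * L + 4) * q ^ s               ≡⟨ cong (2 ^ (5 * L + 4) *_) (sym (^-*-assoc q q (5 * L + 4))) ⟩
      2 ^ (5 * L + 4) * (q ^ q) ^ (5 * L + 4) ≡⟨ sym (*-^ 2 (q ^ q) (5 * L + 4)) ⟩
      (2 * q ^ q) ^ (5 * L + 4)             ≤⟨ ^-monoˡ-≤ (5 * L + 4) (two≤growth q (s≤s z≤n)) ⟩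
      ((q + 1) ^ q) ^ (5 * L + 4)           ≡⟨ ^-*-assoc (q + 1) q (5 * L + 4) ⟩
      (q + 1) ^ s                           ∎
    exponents : ∀ L → 4 * L + (L + 4) ≡ 5 * L + 4
    exponents = solve-∀
    regroup : ∀ a b c d → a * (b * c * d) ≡ b * (a * c) * d
    regroup = solve-∀
    regroup′ : ∀ a b c d e → a * (b * c) * d * e ≡ a * (b * d * e * c)
    regroup′ = solve-∀

red blue : ∀ {m} → (Fin m → Bool) → Colouring m → ℕ
red X ω = count (λ j → ω j ∧ X j)
blue X ω = count (λ j → not (ω j) ∧ X j)

red+blue : ∀ {m} (X : Fin m → Bool) ω → red X ω + blue X ω ≡ count X
red+blue X ω = count-split ω X

-- One step of the moment identity, by the colour of edge zero (x = "edge zero is in X").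
moment-step : ∀ x d′ a b P S → 2 ^ d′ * S ≡ P * (a + b) ^ d′ →
  2 ^ (ind x + d′) * (b ^ ind x * S + a ^ ind x * S) ≡ (2 * P) * (a + b) ^ (ind x + d′)
moment-step true d′ a b P S e = begin
    2 * 2 ^ d′ * (b * 1 * S + a * 1 * S)  ≡⟨ factor (2 ^ d′) a b S ⟩
    2 * (a + b) * (2 ^ d′ * S)            ≡⟨ cong (2 * (a + b) *_) e ⟩
    2 * (a + b) * (P * (a + b) ^ d′)      ≡⟨ regroup P a b ((a + b) ^ d′) ⟩
    2 * P * ((a + b) * (a + b) ^ d′)      ∎
  where
    open ≡-Reasoning
    factor : ∀ x a b S → 2 * x * (b * 1 * S + a * 1 * S) ≡ 2 * (a + b) * (x * S)
    factor = solve-∀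
    regroup : ∀ P a b z → 2 * (a + b) * (P * z) ≡ 2 * P * ((a + b) * z)
    regroup = solve-∀
moment-step false d′ a b P S e = begin
    2 ^ d′ * (1 * S + 1 * S)   ≡⟨ factor (2 ^ d′) S ⟩
    2 * (2 ^ d′ * S)           ≡⟨ cong (2 *_) e ⟩
    2 * (P * (a + b) ^ d′)     ≡⟨ sym (*-assoc 2 P _) ⟩
    2 * P * (a + b) ^ d′       ∎
  where
    open ≡-Reasoning
    factor : ∀ x S → x * (1 * S + 1 * S) ≡ 2 * (x * S)
    factor = solve-∀

moment : ∀ {m} (X : Fin m → Bool) (a b : ℕ) →
  2 ^ count X * sumC (λ ω → a ^ red X ω * b ^ blue X ω) ≡ 2 ^ m * (a + b) ^ count X
moment {zero} X a b = refl
moment {suc m} X a b =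
  trans (cong (2 ^ count X *_) (cong₂ _+_ blue-first red-first))
        (moment-step (X zero) (count X′) a b (2 ^ m) S (moment X′ a b))
  where
    X′ : Fin m → Bool
    X′ j = X (suc j)
    S : ℕ
    S = sumC (λ ω → a ^ red X′ ω * b ^ blue X′ ω)
    i : ℕ
    i = ind (X zero)
    blue-first : sumC (λ ω → a ^ red X′ ω * b ^ (i + blue X′ ω)) ≡ b ^ i * S
    blue-first = trans (sumC-cong (λ ω → trans (cong (a ^ red X′ ω *_) (^-distribˡ-+-* b i (blue X′ ω)))
                                                (x*[y*z]≡y*[x*z] (a ^ red X′ ω) (b ^ i) _)))
                       (sumC-* (b ^ i) (λ ω → a ^ red X′ ω * b ^ blue X′ ω))
      where
        x*[y*z]≡y*[x*z] : ∀ x y z → x * (y * z) ≡ y * (x * z)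
        x*[y*z]≡y*[x*z] = solve-∀
    red-first : sumC (λ ω → a ^ (i + red X′ ω) * b ^ blue X′ ω) ≡ a ^ i * S
    red-first = trans (sumC-cong (λ ω → trans (cong (_* b ^ blue X′ ω) (^-distribˡ-+-* a i (red X′ ω)))
                                               (*-assoc (a ^ i) _ _)))
                      (sumC-* (a ^ i) (λ ω → a ^ red X′ ω * b ^ blue X′ ω))

exponential-markov : ∀ {m} (X : Fin m → Bool) (P : Colouring m → Bool) (a b q K : ℕ) →
  1 ≤ q → a + b ≡ 2 * q → (∀ ω → P ω ≡ true → K * q ^ count X ≤ a ^ red X ω * b ^ blue X ω) →
  K * #sat P ≤ 2 ^ m
exponential-markov {m} X P a b q K q≥1 a+b≡2q heavy =
  *-cancelˡ-≤ (2 ^ d * q ^ d) {{>-nonZero (*-mono-≤ (^-positive 2 d (s≤s z≤n)) (^-positive q d q≥1))}} (begin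
    2 ^ d * q ^ d * (K * #sat P)                   ≡⟨ regroup (2 ^ d) (q ^ d) K (#sat P) ⟩
    2 ^ d * (K * q ^ d * #sat P)                   ≡⟨ cong (2 ^ d *_) (sym (sumC-* (K * q ^ d) (λ ω → ind (P ω)))) ⟩
    2 ^ d * sumC (λ ω → K * q ^ d * ind (P ω))     ≤⟨ *-monoʳ-≤ (2 ^ d) (sumC-mono pointwise) ⟩
    2 ^ d * sumC (λ ω → a ^ red X ω * b ^ blue X ω) ≡⟨ moment X a b ⟩
    2 ^ m * (a + b) ^ d                            ≡⟨ cong (λ w → 2 ^ m * w ^ d) a+b≡2q ⟩
    2 ^ m * (2 * q) ^ d                            ≡⟨ trans (cong (2 ^ m *_) (*-^ 2 q d)) (*-comm (2 ^ m) _) ⟩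
    2 ^ d * q ^ d * 2 ^ m                          ∎)
  where
    open ≤-Reasoning
    d : ℕ
    d = count X
    regroup : ∀ x y K c → x * y * (K * c) ≡ x * (K * y * c)
    regroup = solve-∀
    pointwise : ∀ ω → K * q ^ d * ind (P ω) ≤ a ^ red X ω * b ^ blue X ω
    pointwise ω with P ω in e
    ... | false = ≤-trans (≤-reflexive (*-zeroʳ (K * q ^ d))) z≤n
    ... | true = ≤-trans (≤-reflexive (*-identityʳ (K * q ^ d))) (heavy ω e)

margin : ℕ → ℕ → ℕ
margin p′ L = 2 * suc p′ * (5 * L + 4)

red-heavy blue-heavy : ∀ {m} → (Fin m → Bool) → ℕ → Colouring m → Bool
red-heavy X s ω = blue X ω + s ≤ᵇ red X ω
blue-heavy X s ω = red X ω + s ≤ᵇ blue X ω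

≤ᵇ-sound : ∀ {a b} → (a ≤ᵇ b) ≡ true → a ≤ b
≤ᵇ-sound {a} {b} e = ≤ᵇ⇒≤ a b (subst T (sym e) _)

tail-red : ∀ {m} (X : Fin m → Bool) p′ L → count X ≤ 16 * suc p′ * suc p′ * L →
  2 ^ (L + 4) * #sat (red-heavy X (margin p′ L)) ≤ 2 ^ m
tail-red X p′ L |X|≤ = exponential-markov X (red-heavy X (margin p′ L)) (q + 1) (2 * p′ + 1) q (2 ^ (L + 4))
    (s≤s z≤n) (bases p′) heavy
  where
    q : ℕ
    q = 2 * suc p′
    bases : ∀ p′ → 2 * suc p′ + 1 + (2 * p′ + 1) ≡ 2 * (2 * suc p′)
    bases = solve-∀
    heavy : ∀ ω → red-heavy X (margin p′ L) ω ≡ true →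
      2 ^ (L + 4) * q ^ count X ≤ (q + 1) ^ red X ω * (2 * p′ + 1) ^ blue X ω
    heavy ω e = subst (λ w → 2 ^ (L + 4) * q ^ w ≤ (q + 1) ^ red X ω * (2 * p′ + 1) ^ blue X ω) (red+blue X ω)
      (weight-bound p′ L (red X ω) (blue X ω) (≤-trans (≤-reflexive (red+blue X ω)) |X|≤) (≤ᵇ-sound e))

tail-blue : ∀ {m} (X : Fin m → Bool) p′ L → count X ≤ 16 * suc p′ * suc p′ * L →
  2 ^ (L + 4) * #sat (blue-heavy X (margin p′ L)) ≤ 2 ^ m
tail-blue X p′ L |X|≤ = exponential-markov X (blue-heavy X (margin p′ L)) (2 * p′ + 1) (q + 1) q (2 ^ (L + 4))
    (s≤s z≤n) (bases p′) heavy
  where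
    q : ℕ
    q = 2 * suc p′
    bases : ∀ p′ → 2 * p′ + 1 + (2 * suc p′ + 1) ≡ 2 * (2 * suc p′)
    bases = solve-∀
    blue+red : ∀ ω → blue X ω + red X ω ≡ count X
    blue+red ω = trans (+-comm (blue X ω) (red X ω)) (red+blue X ω)
    heavy : ∀ ω → blue-heavy X (margin p′ L) ω ≡ true →
      2 ^ (L + 4) * q ^ count X ≤ (2 * p′ + 1) ^ red X ω * (q + 1) ^ blue X ω
    heavy ω e = subst₂ (λ w z → 2 ^ (L + 4) * q ^ w ≤ z) (blue+red ω) (*-comm ((q + 1) ^ blue X ω) _)
      (weight-bound p′ L (blue X ω) (red X ω) (≤-trans (≤-reflexive (blue+red ω)) |X|≤) (≤ᵇ-sound e))

deficit≤margin : ∀ x y s → (x + s ≤ᵇ y) ≡ false → (x + y) ∸ 2 * x ≤ s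
deficit≤margin x y s not-heavy = begin
    (x + y) ∸ (x + (x + 0))  ≡⟨ [m+n]∸[m+o]≡n∸o x y (x + 0) ⟩
    y ∸ (x + 0)              ≤⟨ m≤n+o⇒m∸n≤o y (x + 0) (subst (λ w → y ≤ w + s) (sym (+-identityʳ x)) y≤x+s) ⟩
    s                        ∎
  where
    open ≤-Reasoning
    y≤x+s : y ≤ x + s
    y≤x+s with x + s ≤? y
    ... | yes heavy = ⊥-elim (subst T not-heavy (≤⇒≤ᵇ heavy))
    ... | no light = <⇒≤ (≰⇒> light)

²-mono : ∀ {a b} → a ≤ b → a ^ 2 ≤ b ^ 2
²-mono a≤b = *-mono-≤ a≤b (*-monoˡ-≤ 1 a≤b)

margin² : ∀ p′ L d → 1 ≤ L → 4 * suc p′ * suc p′ * L ≤ d → margin p′ L ^ 2 ≤ 81 * d * L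
margin² p′ L d L≥1 4p²L≤d = begin
    margin p′ L ^ 2              ≤⟨ ²-mono (*-monoʳ-≤ (2 * suc p′) 5L+4≤9L) ⟩
    (2 * suc p′ * (9 * L)) ^ 2   ≡⟨ expand (suc p′) L ⟩
    81 * L * (4 * suc p′ * suc p′ * L) ≤⟨ *-monoʳ-≤ (81 * L) 4p²L≤d ⟩
    81 * L * d                   ≡⟨ rearrange L d ⟩
    81 * d * L                   ∎
  where
    open ≤-Reasoning
    5L+4≤9L : 5 * L + 4 ≤ 9 * L
    5L+4≤9L = ≤-trans (+-monoʳ-≤ (5 * L) (*-monoʳ-≤ 4 L≥1)) (≤-reflexive (nine L))
      where
        nine : ∀ L → 5 * L + 4 * L ≡ 9 * L
        nine = solve-∀
    expand : ∀ p L → (2 * p * (9 * L)) * ((2 * p * (9 * L)) * 1) ≡ 81 * L * (4 * p * p * L)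
    expand = solve-∀
    rearrange : ∀ L d → 81 * L * d ≡ 81 * d * L
    rearrange = solve-∀

small-degree : ∀ d L x → d ≤ 4 * L → (d ∸ x) ^ 2 ≤ 81 * d * L
small-degree d L x d≤4L = begin
    (d ∸ x) ^ 2   ≤⟨ ²-mono (m∸n≤m d x) ⟩
    d * (d * 1)   ≤⟨ *-monoʳ-≤ d (≤-trans (≤-reflexive (*-identityʳ d)) (≤-trans d≤4L (*-monoˡ-≤ L {4} {81} (+-monoʳ-≤ 4 z≤n)))) ⟩
    d * (81 * L)  ≡⟨ rearrange d L ⟩
    81 * d * L    ∎
  where
    open ≤-Reasoning
    rearrange : ∀ d L → d * (81 * L) ≡ 81 * d * L
    rearrange = solve-∀

dependsOn-mono : ∀ {m} {X Y : Fin m → Bool} {P : Colouring m → Bool} →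
  (∀ j → X j ≡ true → Y j ≡ true) → DependsOn X P → DependsOn Y P
dependsOn-mono X⊆Y dP ω ω′ agree = dP ω ω′ (λ j x → agree j (X⊆Y j x))

restrict : ∀ {x a a′ : Bool} → (x ≡ true → a ≡ a′) → a ∧ x ≡ a′ ∧ x
restrict {true} h = cong (_∧ true) (h refl)
restrict {false} {a} {a′} h = trans (∧-zeroʳ a) (sym (∧-zeroʳ a′))

red-blue-local : ∀ {m} (X : Fin m → Bool) ω ω′ → (∀ j → X j ≡ true → ω j ≡ ω′ j) →
  red X ω ≡ red X ω′ × blue X ω ≡ blue X ω′
red-blue-local X ω ω′ agree =
  count-cong (λ j → restrict (agree j)) , count-cong (λ j → restrict (λ x → cong not (agree j x)))

module Hypergraph {n m : ℕ} (E : Fin m → Subset n) (R d : ℕ)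
    (regular : Regular d E) (small : ∀ j → ∣ E j ∣ ≤ R) where

  edgesAt : Fin n → Fin m → Bool
  edgesAt v j = Vec.lookup (E j) v

  share : Fin n → Fin n → Bool
  share v u = not (every (λ j → not (edgesAt v j ∧ edgesAt u j)))

  -- v shares an edge with at most R·d vertices: it has d edges of size ≤ R.
  share≤ : ∀ v → count (share v) ≤ R * d
  share≤ v = begin
      count (share v)
        ≡⟨ count≡sum (share v) ⟩
      ∑[ u < n ] ind (share v u)
        ≤⟨ sum-mono shared-edge ⟩
      ∑[ u < n ] ∑[ j < m ] (ind (edgesAt v j) * ind (edgesAt u j))
        ≡⟨ ∑-comm (λ u j → ind (edgesAt v j) * ind (edgesAt u j)) ⟩
      ∑[ j < m ] ∑[ u < n ] (ind (edgesAt v j) * ind (edgesAt u j))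
        ≡⟨ sum-cong-≗ (λ j → sym (*-distribˡ-sum (ind (edgesAt v j)) (λ u → ind (edgesAt u j)))) ⟩
      ∑[ j < m ] (ind (edgesAt v j) * ∑[ u < n ] ind (edgesAt u j))
        ≡⟨ sym (*-identityˡ _) ⟩
      1 * ∑[ j < m ] (ind (edgesAt v j) * ∑[ u < n ] ind (edgesAt u j))
        ≤⟨ sum-selected (edgesAt v) (λ j → ∑[ u < n ] ind (edgesAt u j)) 1 R edge-size ⟩
      count (edgesAt v) * R
        ≡⟨ cong (_* R) (regular v) ⟩
      d * R
        ≡⟨ *-comm d R ⟩
      R * d ∎
    where
      open ≤-Reasoning
      edge-size : ∀ j → edgesAt v j ≡ true → 1 * ∑[ u < n ] ind (edgesAt u j) ≤ R
      edge-size j _ = ≤-trans (≤-reflexive (trans (*-identityˡ _) (sym (trans (card≡count (E j)) (count≡sum (λ u → edgesAt u j)))))) (small j)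
      both : ∀ {a b} → a ∧ b ≡ true → 1 ≤ ind a * ind b
      both {true} {true} _ = s≤s z≤n
      not-false : ∀ {x} → not x ≡ false → x ≡ true
      not-false {true} _ = refl
      shared-edge : ∀ u → ind (share v u) ≤ ∑[ j < m ] (ind (edgesAt v j) * ind (edgesAt u j))
      shared-edge u with every (λ j → not (edgesAt v j ∧ edgesAt u j)) in e
      ... | true = z≤n
      ... | false = let (j , ej) = every-witness e in
        ≤-trans (both {edgesAt v j} {edgesAt u j} (not-false ej)) (term≤sum (λ j → ind (edgesAt v j) * ind (edgesAt u j)) j)

  unbalanced : ℕ → Fin n → Colouring m → Bool
  unbalanced s v ω = red-heavy (edgesAt v) s ω ∨ blue-heavy (edgesAt v) s ω

  unbalanced-local : ∀ s v → DependsOn (edgesAt v) (unbalanced s v)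
  unbalanced-local s v ω ω′ agree = let (r , b) = red-blue-local (edgesAt v) ω ω′ agree in
    cong₂ (λ x y → (y + s ≤ᵇ x) ∨ (x + s ≤ᵇ y)) r b

  module Balanced (p′ L : ℕ) (d≤16p²L : d ≤ 16 * suc p′ * suc p′ * L)
      (Rd≤ : 4 * (R * d) ≤ 2 ^ (L + 3)) (Rd≥1 : 1 ≤ R * d) where

    s : ℕ
    s = margin p′ L

    open LocalLemma (unbalanced s) share (R * d) Rd≥1 share≤

    -- Each bad event has probability at most 2·2^-(L+4) ≤ 1/4Rd.
    unbalanced-rare : ∀ v → 4 * (R * d) * #sat (unbalanced s v) ≤ 2 ^ m
    unbalanced-rare v = *-cancelˡ-≤ 2 (begin
        2 * (4 * (R * d) * #sat (unbalanced s v))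
          ≤⟨ *-monoʳ-≤ 2 (*-mono-≤ Rd≤ (#sat-∨ (red-heavy X s) (blue-heavy X s))) ⟩
        2 * (2 ^ (L + 3) * (#sat (red-heavy X s) + #sat (blue-heavy X s)))
          ≡⟨ distribute (2 ^ (L + 3)) (#sat (red-heavy X s)) (#sat (blue-heavy X s)) ⟩
        2 * 2 ^ (L + 3) * #sat (red-heavy X s) + 2 * 2 ^ (L + 3) * #sat (blue-heavy X s)
          ≡⟨ cong (λ k → 2 ^ k * #sat (red-heavy X s) + 2 ^ k * #sat (blue-heavy X s)) (sym (+-suc L 3)) ⟩
        2 ^ (L + 4) * #sat (red-heavy X s) + 2 ^ (L + 4) * #sat (blue-heavy X s)
          ≤⟨ +-mono-≤ (tail-red X p′ L |X|≤) (tail-blue X p′ L |X|≤) ⟩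
        2 ^ m + 2 ^ m
          ≡⟨ cong (2 ^ m +_) (sym (+-identityʳ (2 ^ m))) ⟩
        2 * 2 ^ m ∎)
      where
        open ≤-Reasoning
        X : Fin m → Bool
        X = edgesAt v
        |X|≤ : count X ≤ 16 * suc p′ * suc p′ * L
        |X|≤ = ≤-trans (≤-reflexive (regular v)) d≤16p²L
        distribute : ∀ a b c → 2 * (a * (b + c)) ≡ 2 * a * b + 2 * a * c
        distribute = solve-∀

    -- Avoiding events of vertices sharing no edge with v is determined by the
    -- edges not at v, hence independent of the bad event of v.
    avoids-local : ∀ v T → (∀ u → T u ≡ true → share v u ≡ false) →
      DependsOn (λ j → not (edgesAt v j)) (avoids T)
    avoids-local v T far ω ω′ agree = every-cong λ u → from-far u
      where
        disjoint-edges : ∀ {x y} → not (x ∧ y) ≡ true → y ≡ true → not x ≡ true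
        disjoint-edges {false} {true} _ _ = refl
        not-false : ∀ {x} → not x ≡ false → x ≡ true
        not-false {true} _ = refl
        from-far : ∀ u → not (T u ∧ unbalanced s u ω) ≡ not (T u ∧ unbalanced s u ω′)
        from-far u with T u in eT
        ... | false = refl
        ... | true = cong not (dependsOn-mono
            (λ j at-u → disjoint-edges (every-elim (not-false (far u eT)) j) at-u)
            (unbalanced-local s u) ω ω′ agree)

    local-condition : LocalCondition
    local-condition v T far = *-cancelʳ-≤ _ _ (2 ^ m) {{>-nonZero (^-positive 2 m (s≤s z≤n))}} (begin
        4 * (R * d) * #sat (λ ω → unbalanced s v ω ∧ avoids T ω) * 2 ^ m
          ≡⟨ *-assoc (4 * (R * d)) _ (2 ^ m) ⟩
        4 * (R * d) * (#sat (λ ω → unbalanced s v ω ∧ avoids T ω) * 2 ^ m)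
          ≡⟨ cong (4 * (R * d) *_) (independent (edgesAt v) (λ j → not (edgesAt v j)) (unbalanced s v) (avoids T)
                                      complement (unbalanced-local s v) (avoids-local v T far)) ⟩
        4 * (R * d) * (#sat (unbalanced s v) * #sat (avoids T))
          ≡⟨ sym (*-assoc (4 * (R * d)) _ _) ⟩
        4 * (R * d) * #sat (unbalanced s v) * #sat (avoids T)
          ≤⟨ *-monoˡ-≤ (#sat (avoids T)) (unbalanced-rare v) ⟩
        2 ^ m * #sat (avoids T)
          ≡⟨ *-comm (2 ^ m) _ ⟩
        #sat (avoids T) * 2 ^ m ∎)
      where
        open ≤-Reasoning
        complement : ∀ j → edgesAt v j ≡ true → not (edgesAt v j) ≡ false
        complement j e = cong not e

    balanced : ∃ λ (c : Colouring m) →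
      (∀ v → d ∸ 2 * degIn E c v ≤ s) × (∀ v → d ∸ 2 * degIn E (λ j → not (c j)) v ≤ s)
    balanced = c , red-class , blue-class
      where
        c : Colouring m
        c = proj₁ (local-lemma local-condition)
        fine : ∀ v → unbalanced s v c ≡ false
        fine = proj₂ (local-lemma local-condition)
        degree : ∀ v → red (edgesAt v) c + blue (edgesAt v) c ≡ d
        degree v = trans (red+blue (edgesAt v) c) (regular v)
        red-class : ∀ v → d ∸ 2 * red (edgesAt v) c ≤ s
        red-class v = subst (λ w → w ∸ 2 * red (edgesAt v) c ≤ s) (degree v)
          (deficit≤margin (red (edgesAt v) c) (blue (edgesAt v) c) s (proj₂ (∨-elim (fine v))))
        blue-class : ∀ v → d ∸ 2 * blue (edgesAt v) c ≤ s
        blue-class v = subst (λ w → w ∸ 2 * blue (edgesAt v) c ≤ s) (trans (+-comm (blue (edgesAt v) c) (red (edgesAt v) c)) (degree v))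
          (deficit≤margin (blue (edgesAt v) c) (red (edgesAt v) c) s (proj₁ (∨-elim (fine v))))

last-before-failure : ∀ (P : ℕ → Set) → (∀ k → Dec (P k)) → ∀ b k →
  P (suc k) → ¬ P (suc k + b) → ∃ λ p′ → P (suc p′) × ¬ P (suc (suc p′))
last-before-failure P P? zero k holds fails = ⊥-elim (fails (subst P (sym (+-identityʳ (suc k))) holds))
last-before-failure P P? (suc b) k holds fails with P? (suc (suc k))
... | yes next = last-before-failure P P? b (suc k) next (subst (λ w → ¬ P w) (+-suc (suc k) b) fails)
... | no stop = k , holds , stop

-- For 4L ≤ d there is p = p′ + 1 with 4p²L ≤ d < 4(p+1)²L ≤ 16p²L.
choose-p : ∀ L d → 1 ≤ L → 4 * L ≤ d →
  ∃ λ p′ → 4 * suc p′ * suc p′ * L ≤ d × d ≤ 16 * suc p′ * suc p′ * L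
choose-p L d L≥1 4L≤d with last-before-failure (λ p → 4 * p * p * L ≤ d) (λ p → 4 * p * p * L ≤? d) d 0 4L≤d
    (λ big → <-irrefl refl (≤-trans (p≤4ppL (suc d) (s≤s z≤n)) big))
  where
    p≤4ppL : ∀ p → 1 ≤ p → p ≤ 4 * p * p * L
    p≤4ppL p p≥1 = ≤-trans (≤-reflexive (sym (*-identityʳ p)))
      (≤-trans (*-monoʳ-≤ p (*-mono-≤ {1} {4} (s≤s z≤n) (*-mono-≤ p≥1 L≥1))) (≤-reflexive (rearrange p L)))
      where
        rearrange : ∀ p L → p * (4 * (p * L)) ≡ 4 * p * p * L
        rearrange = solve-∀
... | p′ , lower , not-next = p′ , lower , ≤-trans (<⇒≤ (≰⇒> not-next)) (≤-trans (m≤m+n _ _) (≤-reflexive (square p′ L)))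
  where
    square : ∀ p L → 4 * suc (suc p) * suc (suc p) * L + (12 * p * p + 16 * p) * L ≡ 16 * suc p * suc p * L
    square = solve-∀

log-positive : ∀ N → 2 ≤ N → 1 ≤ ⌊log₂ N ⌋
log-positive N N≥2 = ≤-trans (≤-reflexive (sym (⌊log₂[2^n]⌋≡n 1))) (⌊log₂⌋-mono-≤ N≥2)

4N≤2^[log+3] : ∀ N → 4 * N ≤ 2 ^ (⌊log₂ N ⌋ + 3)
4N≤2^[log+3] N = ≤-trans (*-monoʳ-≤ 4 (<⇒≤ below-next-power))
    (≤-reflexive (trans (sym (^-distribˡ-+-* 2 2 (L + 1))) (cong (2 ^_) (exponent L))))
  where
    L : ℕ
    L = ⌊log₂ N ⌋
    exponent : ∀ L → 2 + (L + 1) ≡ L + 3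
    exponent = solve-∀
    below-next-power : N < 2 ^ (L + 1)
    below-next-power with 2 ^ (L + 1) ≤? N
    ... | no above = ≰⇒> above
    ... | yes below = ⊥-elim (<-irrefl refl (≤-trans (≤-reflexive log-power) (⌊log₂⌋-mono-≤ below)))
      where
        log-power : suc L ≡ ⌊log₂ (2 ^ (L + 1)) ⌋
        log-power = trans (+-comm 1 L) (sym (⌊log₂[2^n]⌋≡n (L + 1)))

balanced-colouring : ∀ R d → 2 ≤ R * d → ∀ {n m} (E : Fin m → Subset n) →
  Regular d E → (∀ j → ∣ E j ∣ ≤ R) →
  ∃ λ (c : Fin m → Bool) →
    (∀ v → (d ∸ 2 * degIn E c v) ^ 2 ≤ 81 * d * ⌊log₂ (R * d) ⌋)
    × (∀ v → (d ∸ 2 * degIn E (λ j → not (c j)) v) ^ 2 ≤ 81 * d * ⌊log₂ (R * d) ⌋)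
balanced-colouring R d Rd≥2 E regular small with 4 * ⌊log₂ (R * d) ⌋ ≤? d
... | yes 4L≤d =
  let L = ⌊log₂ (R * d) ⌋
      L≥1 = log-positive (R * d) Rd≥2
      (p′ , lower , upper) = choose-p L d L≥1 4L≤d
      (c , red-ok , blue-ok) = Hypergraph.Balanced.balanced E R d regular small p′ L upper
                                 (4N≤2^[log+3] (R * d)) (≤-trans (s≤s z≤n) Rd≥2)
  in c , (λ v → ≤-trans (²-mono (red-ok v)) (margin² p′ L d L≥1 lower))
       , (λ v → ≤-trans (²-mono (blue-ok v)) (margin² p′ L d L≥1 lower))
... | no 4L≰d = (λ _ → true)
  , (λ v → small-degree d L (2 * degIn E (λ _ → true) v) (<⇒≤ (≰⇒> 4L≰d)))
  , (λ v → small-degree d L (2 * degIn E (λ _ → false) v) (<⇒≤ (≰⇒> 4L≰d)))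
  where
    L : ℕ
    L = ⌊log₂ (R * d) ⌋

proposition4 : ∃ λ (C : ℕ) →
    ∀ (R d : ℕ) → 1 ≤ R → 1 ≤ d → 2 ≤ R * d →
    ∀ (n m : ℕ) (E : Fin m → Subset n) →
    Regular d E → (∀ j → ∣ E j ∣ ≤ R) →
    ∃ λ (c : Fin m → Bool) →
      (∀ v → (d ∸ 2 * degIn E c v) ^ 2 ≤ C * d * ⌊log₂ (R * d) ⌋)
      × (∀ v → (d ∸ 2 * degIn E (λ j → not (c j)) v) ^ 2 ≤ C * d * ⌊log₂ (R * d) ⌋)
proposition4 = 81 , λ R d _ _ Rd≥2 n m E → balanced-colouring R d Rd≥2 E
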